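{- Let $G$ be a connected graph of order $n$ with vertex set $V$, and let $H\subseteq V$ be a connected set of size $h\geq 1$. Then \[A(G,H)\geq \frac{n+h}{2}.\]
   Context: A subset $U\subseteq V$ is a connected set if the subgraph of $G$ induced by $U$ is connected. For a connected set $H$, $N(G,H)$ denotes the number of connected sets of $G$ containing $H$, $S(G,H)$ the sum of the sizes of all connected sets of $G$ containing $H$, and $A(G,H)=S(G,H)/N(G,H)$ the average size of a connected set containing $H$. -}

module Defs where

open import Data.Nat using (ℕ)
open import Data.Fin using (Fin)
open import Data.Fin.Subset using (Subset; _∈_; _⊆_; ⊤)
open import Data.Product using (_×_)
open import Relation.Nullary using (¬_)

record Graph (n : ℕ) : Set₁ where
  field
    Adj   : Fin n → Fin n → Set
    sym   : ∀ {u v} → Adj u v → Adj v u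
    irrefl : ∀ {u} → ¬ Adj u u

open Graph public

data Walk {n : ℕ} (G : Graph n) (U : Subset n) : Fin n → Fin n → Set where
  here : ∀ {u} → u ∈ U → Walk G U u u
  step : ∀ {u w v} → u ∈ U → Adj G u w → Walk G U w v → Walk G U u v

ConnectedSet : {n : ℕ} → Graph n → Subset n → Set
ConnectedSet G U = ∀ u v → u ∈ U → v ∈ U → Walk G U u v

ConnectedGraph : {n : ℕ} → Graph n → Set
ConnectedGraph G = ConnectedSet G ⊤

-- Fix a vertex v ∉ H adjacent to H.  The connected sets between H and W that contain v are those
-- between H ∪ {v} and W.  Those avoiding v are closed under union (they share H), so they have a
-- largest member R and are exactly the connected sets between H and R.  Growing the connected set
-- R ∪ {v} one vertex at a time gives a chain of ∣W∣ − ∣R∣ connected sets Y up to W, and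
-- (U , Y) ↦ U ∪ (Y ∖ R) maps pairs of a set avoiding v and a chain member injectively to sets
-- containing v.  Each U ∪ (Y ∖ R) is connected because v is the only vertex of W ∖ R adjacent to R
-- (any other would enlarge R).  So sets containing v outnumber those avoiding it by a factor
-- ∣W∣ − ∣R∣, which lets the induction hypotheses, average size ≥ (∣R∣ + ∣H∣)/2 for the sets
-- avoiding v and ≥ (∣W∣ + ∣H∣ + 1)/2 for those containing it, combine to (∣W∣ + ∣H∣)/2.
module Submission where

open import Defs
open import Data.Nat using (ℕ; _+_; _*_; _≤_; _≥_)
open import Data.Fin.Subset using (Subset; _⊆_; ∣_∣)
open import Data.List using (List; length; map)
open import Data.Nat.ListAction using (sum)
open import Data.List.Membership.Propositional using () renaming (_∈_ to _∈L_)
open import Data.List.Relation.Unary.Unique.Propositional using (Unique)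
open import Data.Product using (_×_)
open import Function.Bundles using (_⇔_)

open import Data.Nat using (zero; suc; _<_; z≤n; s≤s)
open import Data.Nat.Properties
  using (+-comm; +-suc; *-distribˡ-+; +-mono-≤; +-monoˡ-≤; +-monoʳ-≤; *-monoˡ-≤;
         <⇒≱; ≤-pred; <-≤-trans; ≤-reflexive; m≤m+n; module ≤-Reasoning)
open import Data.Nat.ListAction.Properties using (sum-++; sum-↭)
open import Data.Nat.Solver using (module +-*-Solver)
open import Data.Fin using (Fin; zero; suc)
open import Data.Fin.Properties using (any?; _≟_)
open import Data.Fin.Subset using (_∈_; _∉_; _∪_; _∩_; ∁; ⁅_⁆; ⊤; inside; outside; Nonempty)
open import Data.Fin.Subset.Properties
open import Data.Vec using (_∷_; here; there)
open import Data.List using ([]; _∷_; _++_; filter; foldr; cartesianProduct)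
open import Data.List.Properties using (length-++; length-map; length-++-sucʳ; map-++)
open import Data.List.Membership.Propositional.Properties
  using (∈-∃++; ∈-++⁻; ∈-++⁺ˡ; ∈-++⁺ʳ; ∈-map⁻; ∈-filter⁺; ∈-filter⁻; ∈-cartesianProduct⁻)
open import Data.List.Relation.Binary.Permutation.Propositional using (_↭_; prep; ↭-trans; ↭-sym)
open import Data.List.Relation.Binary.Permutation.Propositional.Properties
  using (shift; ↭-length) renaming (map⁺ to ↭-map⁺)
import Data.List.Relation.Unary.Any as Any
open import Data.List.Relation.Unary.All as All using (All; []; _∷_)
open import Data.List.Relation.Unary.All.Properties using () renaming (map⁺ to All-map⁺)
open import Data.List.Relation.Unary.AllPairs using ([]; _∷_)
open import Data.List.Relation.Unary.Unique.Propositional.Properties using (filter⁺; cartesianProduct⁺)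
open import Data.Product using (_,_; ∃; ∃₂; proj₁; proj₂)
open import Data.Sum using (_⊎_; inj₁; inj₂; [_,_]′)
open import Data.Empty using (⊥-elim)
open import Function using (_∘_)
open import Function.Bundles using (mk⇔; Equivalence)
open import Function.Construct.Composition using (_⇔-∘_)
open import Level using (Level)
open import Relation.Binary.PropositionalEquality as ≡
  using (_≡_; _≢_; refl; cong; cong₂; subst; subst₂; module ≡-Reasoning)
open import Relation.Nullary using (yes; no)
open import Relation.Nullary.Decidable using (¬?; _×-dec_)
open import Relation.Unary using (Pred; Decidable)

-- Lists

module _ {A : Set} {ℓ : Level} {P : Pred A ℓ} (P? : Decidable P) where

  filter-++-filter-¬-↭ : (xs : List A) → xs ↭ filter P? xs ++ filter (¬? ∘ P?) xs
  filter-++-filter-¬-↭ [] = _↭_.refl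
  filter-++-filter-¬-↭ (x ∷ xs) with P? x
  ... | yes _ = prep x (filter-++-filter-¬-↭ xs)
  ... | no  _ = ↭-trans (prep x (filter-++-filter-¬-↭ xs)) (↭-sym (shift x (filter P? xs) _))

  length-filter-split : (xs : List A) → length xs ≡ length (filter P? xs) + length (filter (¬? ∘ P?) xs)
  length-filter-split xs = ≡.trans (↭-length (filter-++-filter-¬-↭ xs)) (length-++ (filter P? xs))

  sum-map-filter-split : (xs : List A) (f : A → ℕ) →
                         sum (map f xs) ≡ sum (map f (filter P? xs)) + sum (map f (filter (¬? ∘ P?) xs))
  sum-map-filter-split xs f = begin
    sum (map f xs)
      ≡⟨ sum-↭ (↭-map⁺ f (filter-++-filter-¬-↭ xs)) ⟩
    sum (map f (filter P? xs ++ filter (¬? ∘ P?) xs))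
      ≡⟨ cong sum (map-++ f (filter P? xs) _) ⟩
    sum (map f (filter P? xs) ++ map f (filter (¬? ∘ P?) xs))
      ≡⟨ sum-++ (map f (filter P? xs)) _ ⟩
    sum (map f (filter P? xs)) + sum (map f (filter (¬? ∘ P?) xs)) ∎
    where open ≡-Reasoning

module _ {A : Set} where

  Unique⇒length≤ : {xs ys : List A} → Unique xs → (∀ {x} → x ∈L xs → x ∈L ys) → length xs ≤ length ys
  Unique⇒length≤ {[]} _ _ = z≤n
  Unique⇒length≤ {x ∷ xs} (x∉xs ∷ xs!) xs⊆ys
    with as , bs , refl ← ∈-∃++ (xs⊆ys (Any.here refl)) =
    subst (suc (length xs) ≤_) (≡.sym (length-++-sucʳ as x bs)) (s≤s (Unique⇒length≤ xs! xs⊆as++bs))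
    where
    xs⊆as++bs : ∀ {y} → y ∈L xs → y ∈L as ++ bs
    xs⊆as++bs y∈xs with ∈-++⁻ as (xs⊆ys (Any.there y∈xs))
    ... | inj₁ y∈as             = ∈-++⁺ˡ y∈as
    ... | inj₂ (Any.here refl)  = ⊥-elim (All.lookup x∉xs y∈xs refl)
    ... | inj₂ (Any.there y∈bs) = ∈-++⁺ʳ as y∈bs

  _Enumerates_ : List A → (A → Set) → Set
  L Enumerates P = Unique L × (∀ x → x ∈L L ⇔ P x)

  Enumerates-resp-⇔ : {L : List A} {P Q : A → Set} → (∀ x → P x ⇔ Q x) → L Enumerates P → L Enumerates Q
  Enumerates-resp-⇔ P⇔Q (L! , L⇔P) = L! , λ x → P⇔Q x ⇔-∘ L⇔P x

  filter-Enumerates : {L : List A} {P Q : A → Set} (Q? : Decidable Q) →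
                      L Enumerates P → filter Q? L Enumerates (λ x → P x × Q x)
  filter-Enumerates {L} Q? (L! , L⇔P) = filter⁺ Q? L! , λ x → mk⇔
    (λ x∈ → let x∈L , Qx = ∈-filter⁻ Q? {xs = L} x∈ in Equivalence.to (L⇔P x) x∈L , Qx)
    (λ (Px , Qx) → ∈-filter⁺ Q? (Equivalence.from (L⇔P x) Px) Qx)

  Enumerates-≡⇒singleton : {L : List A} {a : A} → L Enumerates (_≡ a) → L ≡ a ∷ []
  Enumerates-≡⇒singleton {[]} {a} (_ , L⇔≡a) with () ← Equivalence.from (L⇔≡a a) refl
  Enumerates-≡⇒singleton {x ∷ []} (_ , L⇔≡a) = cong (_∷ []) (Equivalence.to (L⇔≡a x) (Any.here refl))
  Enumerates-≡⇒singleton {x ∷ y ∷ _} ((x∉ ∷ _) , L⇔≡a) =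
    ⊥-elim (All.head x∉ (≡.trans (Equivalence.to (L⇔≡a x) (Any.here refl))
                                 (≡.sym (Equivalence.to (L⇔≡a y) (Any.there (Any.here refl))))))

module _ {A B : Set} (f : A → B) where

  InjectiveOn : List A → Set
  InjectiveOn xs = ∀ {x y} → x ∈L xs → y ∈L xs → f x ≡ f y → x ≡ y

  Unique-map⁺ : {xs : List A} → InjectiveOn xs → Unique xs → Unique (map f xs)
  Unique-map⁺ {[]} _ [] = []
  Unique-map⁺ {x ∷ xs} inj (x∉xs ∷ xs!) =
    All-map⁺ (All.tabulate λ y∈xs fx≡fy →
                All.lookup x∉xs y∈xs (inj (Any.here refl) (Any.there y∈xs) fx≡fy))
    ∷ Unique-map⁺ (λ x∈ y∈ → inj (Any.there x∈) (Any.there y∈)) xs!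

  length≤-by-injection : {xs : List A} {ys : List B} → Unique xs → InjectiveOn xs →
                         (∀ {x} → x ∈L xs → f x ∈L ys) → length xs ≤ length ys
  length≤-by-injection {xs} {ys} xs! inj f[xs]⊆ys =
    subst (_≤ length ys) (length-map f xs) (Unique⇒length≤ (Unique-map⁺ inj xs!) map-f-xs⊆ys)
    where
    map-f-xs⊆ys : ∀ {y} → y ∈L map f xs → y ∈L ys
    map-f-xs⊆ys y∈ with _ , x∈xs , refl ← ∈-map⁻ f y∈ = f[xs]⊆ys x∈xs

length-cartesianProduct : {A B : Set} (xs : List A) (ys : List B) →
                          length (cartesianProduct xs ys) ≡ length xs * length ys
length-cartesianProduct []       ys = refl
length-cartesianProduct (x ∷ xs) ys = ≡.trans (length-++ (map (x ,_) ys))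
  (cong₂ _+_ (length-map (x ,_) ys) (length-cartesianProduct xs ys))

-- Subsets of Fin n

m+∣p∪⁅x⁆∣≡1+m+∣p∣ : {n : ℕ} {p : Subset n} {x : Fin n} (m : ℕ) → x ∉ p →
                    m + ∣ p ∪ ⁅ x ⁆ ∣ ≡ suc (m + ∣ p ∣)
m+∣p∪⁅x⁆∣≡1+m+∣p∣ m x∉p = ≡.trans (cong (m +_) (∣p∪⁅x⁆∣≡1+∣p∣ x∉p)) (+-suc m _)
  where
  ∣p∪⁅x⁆∣≡1+∣p∣ : {n : ℕ} {p : Subset n} {x : Fin n} → x ∉ p → ∣ p ∪ ⁅ x ⁆ ∣ ≡ suc ∣ p ∣
  ∣p∪⁅x⁆∣≡1+∣p∣ {p = outside ∷ p} {zero}  _   = cong (suc ∘ ∣_∣) (∪-identityʳ p)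
  ∣p∪⁅x⁆∣≡1+∣p∣ {p = inside  ∷ p} {zero}  x∉p = ⊥-elim (x∉p here)
  ∣p∪⁅x⁆∣≡1+∣p∣ {p = outside ∷ p} {suc x} x∉p = ∣p∪⁅x⁆∣≡1+∣p∣ (x∉p ∘ there)
  ∣p∪⁅x⁆∣≡1+∣p∣ {p = inside  ∷ p} {suc x} x∉p = cong suc (∣p∪⁅x⁆∣≡1+∣p∣ (x∉p ∘ there))

module _ {n : ℕ} where

  1≤∣p∣⇒Nonempty : {p : Subset n} → 1 ≤ ∣ p ∣ → Nonempty p
  1≤∣p∣⇒Nonempty {p} 1≤∣p∣ with nonempty? p
  ... | yes p≢∅ = p≢∅
  ... | no  p≡∅ = ⊥-elim (<⇒≱ 1≤∣p∣ (≤-reflexive (≡.trans (cong ∣_∣ (Empty-unique p≡∅)) (∣⊥∣≡0 n))))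

  ⊆⊎∃∉ : (p q : Subset n) → p ⊆ q ⊎ ∃ λ x → x ∈ p × x ∉ q
  ⊆⊎∃∉ p q with any? (λ x → (x ∈? p) ×-dec ¬? (x ∈? q))
  ... | yes witness = inj₂ witness
  ... | no  none    = inj₁ p⊆q
    where
    p⊆q : p ⊆ q
    p⊆q {x} x∈p with x ∈? q
    ... | yes x∈q = x∈q
    ... | no  x∉q = ⊥-elim (none (x , x∈p , x∉q))

  ∪-⊆ : {p q r : Subset n} → p ⊆ r → q ⊆ r → p ∪ q ⊆ r
  ∪-⊆ {p} {q} p⊆r q⊆r x∈p∪q = [ p⊆r , q⊆r ]′ (x∈p∪q⁻ p q x∈p∪q)

  x∈p∪⁅x⁆ : (p : Subset n) (x : Fin n) → x ∈ p ∪ ⁅ x ⁆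
  x∈p∪⁅x⁆ p x = q⊆p∪q p ⁅ x ⁆ (x∈⁅x⁆ x)

  p∪⁅x⁆⊆q : {p q : Subset n} {x : Fin n} → p ⊆ q → x ∈ q → p ∪ ⁅ x ⁆ ⊆ q
  p∪⁅x⁆⊆q {x = x} p⊆q x∈q = ∪-⊆ p⊆q λ y∈⁅x⁆ → subst (_∈ _) (≡.sym (x∈⁅y⁆⇒x≡y x y∈⁅x⁆)) x∈q

  ∪-∩∁-injective : {r p p′ q q′ : Subset n} → p ⊆ r → p′ ⊆ r → r ⊆ q → r ⊆ q′ →
                   p ∪ (q ∩ ∁ r) ≡ p′ ∪ (q′ ∩ ∁ r) → p ≡ p′ × q ≡ q′
  ∪-∩∁-injective p⊆r p′⊆r r⊆q r⊆q′ eq =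
    ⊆-antisym (⊆-left p⊆r eq) (⊆-left p′⊆r (≡.sym eq)) ,
    ⊆-antisym (⊆-right p′⊆r r⊆q′ eq) (⊆-right p⊆r r⊆q (≡.sym eq))
    where
    ⊆-left : ∀ {r p p′ q q′} → p ⊆ r → p ∪ (q ∩ ∁ r) ≡ p′ ∪ (q′ ∩ ∁ r) → p ⊆ p′
    ⊆-left {r} {p} {p′} {q} {q′} p⊆r eq {x} x∈p
      with x∈p∪q⁻ p′ (q′ ∩ ∁ r) (subst (x ∈_) eq (p⊆p∪q (q ∩ ∁ r) x∈p))
    ... | inj₁ x∈p′   = x∈p′
    ... | inj₂ x∈q′∖r = ⊥-elim (x∈∁p⇒x∉p (proj₂ (x∈p∩q⁻ q′ (∁ r) x∈q′∖r)) (p⊆r x∈p))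
    ⊆-right : ∀ {r p p′ q q′} → p′ ⊆ r → r ⊆ q′ → p ∪ (q ∩ ∁ r) ≡ p′ ∪ (q′ ∩ ∁ r) → q ⊆ q′
    ⊆-right {r} {p} {p′} {q} {q′} p′⊆r r⊆q′ eq {x} x∈q with x ∈? r
    ... | yes x∈r = r⊆q′ x∈r
    ... | no  x∉r
      with x∈p∪q⁻ p′ (q′ ∩ ∁ r) (subst (x ∈_) eq (q⊆p∪q p (q ∩ ∁ r) (x∈p∩q⁺ (x∈q , x∉p⇒x∈∁p x∉r))))
    ...   | inj₁ x∈p′   = ⊥-elim (x∉r (p′⊆r x∈p′))
    ...   | inj₂ x∈q′∖r = proj₁ (x∈p∩q⁻ q′ (∁ r) x∈q′∖r)

  ⊆-foldr-∪ : {p q : Subset n} {ps : List (Subset n)} → p ∈L ps → p ⊆ foldr _∪_ q ps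
  ⊆-foldr-∪ {ps = p ∷ ps} (Any.here refl) = p⊆p∪q (foldr _∪_ _ ps)
  ⊆-foldr-∪ {ps = p ∷ ps} (Any.there p∈ps) = q⊆p∪q p (foldr _∪_ _ ps) ∘ ⊆-foldr-∪ p∈ps

  foldr-∪-closed : {ℓ : Level} {P : Pred (Subset n) ℓ} → (∀ {p q} → P p → P q → P (p ∪ q)) →
                   {q : Subset n} {ps : List (Subset n)} → P q → All P ps → P (foldr _∪_ q ps)
  foldr-∪-closed ∪-closed Pq []         = Pq
  foldr-∪-closed ∪-closed Pq (Pp ∷ Pps) = ∪-closed Pp (foldr-∪-closed ∪-closed Pq Pps)

averages-combine : ∀ {w r h N₀ N₁} S₀ S₁ → (r + h) * N₀ ≤ 2 * S₀ → suc (w + h) * N₁ ≤ 2 * S₁ →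
                   (∃ λ d → N₀ * d ≤ N₁ × w ≤ d + r) → (w + h) * (N₁ + N₀) ≤ 2 * (S₁ + S₀)
averages-combine {w} {r} {h} {N₀} {N₁} S₀ S₁ bound₀ bound₁ (d , N₀d≤N₁ , w≤d+r) = begin
  (w + h) * (N₁ + N₀)                  ≡⟨ *-distribˡ-+ (w + h) N₁ N₀ ⟩
  (w + h) * N₁ + (w + h) * N₀          ≤⟨ +-monoʳ-≤ ((w + h) * N₁) (*-monoˡ-≤ N₀ (+-monoˡ-≤ h w≤d+r)) ⟩
  (w + h) * N₁ + (d + r + h) * N₀      ≡⟨ regroup w h N₁ d r N₀ ⟩
  (w + h) * N₁ + N₀ * d + (r + h) * N₀ ≤⟨ +-monoˡ-≤ ((r + h) * N₀) (+-monoʳ-≤ ((w + h) * N₁) N₀d≤N₁) ⟩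
  (w + h) * N₁ + N₁ + (r + h) * N₀     ≡⟨ cong (_+ (r + h) * N₀) (+-comm ((w + h) * N₁) N₁) ⟩
  suc (w + h) * N₁ + (r + h) * N₀      ≤⟨ +-mono-≤ bound₁ bound₀ ⟩
  2 * S₁ + 2 * S₀                      ≡⟨ *-distribˡ-+ 2 S₁ S₀ ⟨
  2 * (S₁ + S₀)                        ∎
  where
  open ≤-Reasoning
  open +-*-Solver using (solve; _:+_; _:*_; _:=_)
  regroup : ∀ w h N₁ d r N₀ → (w + h) * N₁ + (d + r + h) * N₀ ≡ (w + h) * N₁ + N₀ * d + (r + h) * N₀
  regroup = solve 6 (λ w h N₁ d r N₀ → (w :+ h) :* N₁ :+ (d :+ r :+ h) :* N₀
                                     := (w :+ h) :* N₁ :+ N₀ :* d :+ (r :+ h) :* N₀) refl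

-- Walks and connected sets

module _ {n : ℕ} (G : Graph n) where

  private variable
    A B U U′ Y : Subset n
    a b c r u v x y : Fin n

  Walk-mono : U ⊆ U′ → Walk G U a b → Walk G U′ a b
  Walk-mono U⊆U′ (here a∈U)          = here (U⊆U′ a∈U)
  Walk-mono U⊆U′ (step a∈U adj walk) = step (U⊆U′ a∈U) adj (Walk-mono U⊆U′ walk)

  _++ʷ_ : Walk G U a b → Walk G U b c → Walk G U a c
  here _            ++ʷ walk′ = walk′
  step a∈U adj walk ++ʷ walk′ = step a∈U adj (walk ++ʷ walk′)

  Walk-start : Walk G U a b → a ∈ U
  Walk-start (here a∈U)     = a∈U
  Walk-start (step a∈U _ _) = a∈U

  Walk-reverse : Walk G U a b → Walk G U b a
  Walk-reverse (here a∈U)          = here a∈U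
  Walk-reverse (step a∈U adj walk) = Walk-reverse walk ++ʷ step (Walk-start walk) (sym G adj) (here a∈U)

  walks-to⇒ConnectedSet : (∀ u → u ∈ U → Walk G U u r) → ConnectedSet G U
  walks-to⇒ConnectedSet walk-to u v u∈U v∈U = walk-to u u∈U ++ʷ Walk-reverse (walk-to v v∈U)

  ∪-connected : r ∈ A → r ∈ B → ConnectedSet G A → ConnectedSet G B → ConnectedSet G (A ∪ B)
  ∪-connected {r = r} {A = A} {B = B} r∈A r∈B A-conn B-conn = walks-to⇒ConnectedSet walk-to
    where
    walk-to : ∀ u → u ∈ A ∪ B → Walk G (A ∪ B) u r
    walk-to u u∈A∪B with x∈p∪q⁻ A B u∈A∪B
    ... | inj₁ u∈A = Walk-mono (p⊆p∪q B)   (A-conn u r u∈A r∈A)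
    ... | inj₂ u∈B = Walk-mono (q⊆p∪q A B) (B-conn u r u∈B r∈B)

  ∪⁅⁆-connected : ConnectedSet G A → a ∈ A → Adj G x a → ConnectedSet G (A ∪ ⁅ x ⁆)
  ∪⁅⁆-connected {A = A} {a = a} {x = x} A-conn a∈A adj = walks-to⇒ConnectedSet walk-to
    where
    walk-to : ∀ u → u ∈ A ∪ ⁅ x ⁆ → Walk G (A ∪ ⁅ x ⁆) u a
    walk-to u u∈A∪x with x∈p∪q⁻ A ⁅ x ⁆ u∈A∪x
    ... | inj₁ u∈A = Walk-mono (p⊆p∪q ⁅ x ⁆) (A-conn u a u∈A a∈A)
    ... | inj₂ u∈x with refl ← x∈⁅y⁆⇒x≡y x u∈x = step u∈A∪x adj (here (p⊆p∪q ⁅ x ⁆ a∈A))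

  exit-edge : Walk G U a b → a ∈ A → b ∉ A → ∃₂ λ p q → p ∈ A × q ∉ A × q ∈ U × Adj G p q
  exit-edge (here _) a∈A b∉A = ⊥-elim (b∉A a∈A)
  exit-edge {A = A} (step {w = w} _ adj walk) a∈A b∉A with w ∈? A
  ... | yes w∈A = exit-edge walk w∈A b∉A
  ... | no  w∉A = _ , w , a∈A , w∉A , Walk-start walk , adj

  ExitsOnlyThrough : Subset n → Subset n → Fin n → Set
  ExitsOnlyThrough Y R v = ∀ {x w} → x ∈ Y → x ≢ v → Adj G x w → w ∈ R → x ∈ R

  walk-into⇒walk-to-exit : {R : Subset n} → ExitsOnlyThrough Y R v → Walk G Y x y → y ∈ R → x ∉ R →
                           Walk G (Y ∩ ∁ R) x v
  walk-into⇒walk-to-exit exits (here _) y∈R x∉R = ⊥-elim (x∉R y∈R)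
  walk-into⇒walk-to-exit {v = v} {x = x} {R = R} exits (step {w = w} x∈Y adj walk) y∈R x∉R
    with x ≟ v | w ∈? R
  ... | yes refl | _       = here (x∈p∩q⁺ (x∈Y , x∉p⇒x∈∁p x∉R))
  ... | no  x≢v  | yes w∈R = ⊥-elim (x∉R (exits x∈Y x≢v adj w∈R))
  ... | no  x≢v  | no  w∉R =
    step (x∈p∩q⁺ (x∈Y , x∉p⇒x∈∁p x∉R)) adj (walk-into⇒walk-to-exit exits walk y∈R w∉R)

  ∪-∩∁-connected : {R : Subset n} → ExitsOnlyThrough Y R v → ConnectedSet G U → ConnectedSet G Y →
                   U ⊆ R → R ⊆ Y → r ∈ U → u ∈ U → Adj G v u → v ∈ Y → v ∉ R →
                   ConnectedSet G (U ∪ (Y ∩ ∁ R))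
  ∪-∩∁-connected {Y = Y} {U = U} {r = r} {u = u} {R = R}
                 exits U-conn Y-conn U⊆R R⊆Y r∈U u∈U adj v∈Y v∉R =
    walks-to⇒ConnectedSet walk-to
    where
    walk-to : ∀ x → x ∈ U ∪ (Y ∩ ∁ R) → Walk G (U ∪ (Y ∩ ∁ R)) x r
    walk-to x x∈ with x∈p∪q⁻ U (Y ∩ ∁ R) x∈
    ... | inj₁ x∈U   = Walk-mono (p⊆p∪q (Y ∩ ∁ R)) (U-conn x r x∈U r∈U)
    ... | inj₂ x∈Y∖R with x∈Y , x∈∁R ← x∈p∩q⁻ Y (∁ R) x∈Y∖R =
      Walk-mono (q⊆p∪q U (Y ∩ ∁ R))
        (walk-into⇒walk-to-exit exits (Y-conn x r x∈Y (R⊆Y (U⊆R r∈U))) (U⊆R r∈U) (x∈∁p⇒x∉p x∈∁R))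
      ++ʷ step (q⊆p∪q U (Y ∩ ∁ R) (x∈p∩q⁺ (v∈Y , x∉p⇒x∈∁p v∉R))) adj
            (Walk-mono (p⊆p∪q (Y ∩ ∁ R)) (U-conn u r u∈U r∈U))

  ConnectedBetween : Subset n → Subset n → Subset n → Set
  ConnectedBetween H W U = H ⊆ U × U ⊆ W × ConnectedSet G U

  ConnectedBetween-∋⇔∪⁅⁆ : {H W : Subset n} →
                           ∀ U → (ConnectedBetween H W U × v ∈ U) ⇔ ConnectedBetween (H ∪ ⁅ v ⁆) W U
  ConnectedBetween-∋⇔∪⁅⁆ {v = v} {H = H} {W = W} U = mk⇔ to from
    where
    to : ConnectedBetween H W U × v ∈ U → ConnectedBetween (H ∪ ⁅ v ⁆) W U
    to ((H⊆U , U-rest) , v∈U) = p∪⁅x⁆⊆q H⊆U v∈U , U-rest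
    from : ConnectedBetween (H ∪ ⁅ v ⁆) W U → ConnectedBetween H W U × v ∈ U
    from (H∪v⊆U , U-rest) = ((λ x∈H → H∪v⊆U (p⊆p∪q ⁅ v ⁆ x∈H)) , U-rest) , H∪v⊆U (x∈p∪⁅x⁆ H v)

  ConnectedBetween-⊇⇔≡ : {H W : Subset n} → ConnectedSet G H → H ⊆ W → W ⊆ H →
                          ∀ U → ConnectedBetween H W U ⇔ U ≡ H
  ConnectedBetween-⊇⇔≡ H-conn H⊆W W⊆H U =
    mk⇔ (λ (H⊆U , U⊆W , _) → ⊆-antisym (W⊆H ∘ U⊆W) H⊆U) λ { refl → ⊆-refl , H⊆W , H-conn }

  ConnectedBetween-⊤⇔ : {H : Subset n} → ∀ U → (H ⊆ U × ConnectedSet G U) ⇔ ConnectedBetween H ⊤ U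
  ConnectedBetween-⊤⇔ {H} U = mk⇔ to from
    where
    to : H ⊆ U × ConnectedSet G U → ConnectedBetween H ⊤ U
    to (H⊆U , U-conn) = H⊆U , ⊆⊤ , U-conn
    from : ConnectedBetween H ⊤ U → H ⊆ U × ConnectedSet G U
    from (H⊆U , _ , U-conn) = H⊆U , U-conn

  connected-chain : ∀ k {A W : Subset n} → ∣ W ∣ ≤ k + ∣ A ∣ → a ∈ A →
                    ConnectedSet G A → ConnectedSet G W → A ⊆ W →
                    ∃ λ (Ys : List (Subset n)) →
                      Unique Ys × All (ConnectedBetween A W) Ys × ∣ W ∣ < length Ys + ∣ A ∣
  connected-chain {a = a} k {A} {W} W≤k+A a∈A A-conn W-conn A⊆W with ⊆⊎∃∉ W A
  ... | inj₁ W⊆A = A ∷ [] , [] ∷ [] , (⊆-refl , A⊆W , A-conn) ∷ [] , s≤s (p⊆q⇒∣p∣≤∣q∣ W⊆A)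
  ... | inj₂ (x , x∈W , x∉A) with exit-edge (W-conn a x (A⊆W a∈A) x∈W) a∈A x∉A | k
  ...   | _ | zero = ⊥-elim (<⇒≱ (p⊂q⇒∣p∣<∣q∣ (A⊆W , x , x∈W , x∉A)) W≤k+A)
  ...   | p , q , p∈A , q∉A , q∈W , p~q | suc k
    with Ys , Ys! , Ys-between , W<Ys+A∪q ←
           connected-chain k (subst (∣ W ∣ ≤_) (≡.sym (m+∣p∪⁅x⁆∣≡1+m+∣p∣ k q∉A)) W≤k+A) (p⊆p∪q ⁅ q ⁆ a∈A)
             (∪⁅⁆-connected A-conn p∈A (sym G p~q)) W-conn (p∪⁅x⁆⊆q A⊆W q∈W)
    = A ∷ Ys , All.map A≢ Ys-between ∷ Ys! , (⊆-refl , A⊆W , A-conn) ∷ All.map shrink Ys-between ,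
      subst (∣ W ∣ <_) (m+∣p∪⁅x⁆∣≡1+m+∣p∣ (length Ys) q∉A) W<Ys+A∪q
    where
    A≢ : ∀ {Y} → ConnectedBetween (A ∪ ⁅ q ⁆) W Y → A ≢ Y
    A≢ (A∪q⊆Y , _) refl = q∉A (A∪q⊆Y (x∈p∪⁅x⁆ A q))
    shrink : ∀ {Y} → ConnectedBetween (A ∪ ⁅ q ⁆) W Y → ConnectedBetween A W Y
    shrink (A∪q⊆Y , Y-rest) = (λ x∈A → A∪q⊆Y (p⊆p∪q ⁅ q ⁆ x∈A)) , Y-rest

  splice : Subset n → Subset n × Subset n → Subset n
  splice R (U , Y) = U ∪ (Y ∩ ∁ R)

  splice-between : {H R W : Subset n} → ExitsOnlyThrough W R v → r ∈ H → u ∈ H → Adj G v u → v ∉ R →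
                   ConnectedBetween H R U → ConnectedBetween (R ∪ ⁅ v ⁆) W Y →
                   ConnectedBetween (H ∪ ⁅ v ⁆) W (splice R (U , Y))
  splice-between {v = v} {U = U} {Y = Y} {H = H} {R = R} {W = W} exits r∈H u∈H v~u v∉R
                 (H⊆U , U⊆R , U-conn) (R∪v⊆Y , Y⊆W , Y-conn) =
      p∪⁅x⁆⊆q (p⊆p∪q (Y ∩ ∁ R) ∘ H⊆U) (q⊆p∪q U (Y ∩ ∁ R) (x∈p∩q⁺ (v∈Y , x∉p⇒x∈∁p v∉R)))
    , ∪-⊆ (Y⊆W ∘ R⊆Y ∘ U⊆R) (Y⊆W ∘ p∩q⊆p Y (∁ R))
    , ∪-∩∁-connected (exits ∘ Y⊆W) U-conn Y-conn U⊆R R⊆Y (H⊆U r∈H) (H⊆U u∈H) v~u v∈Y v∉R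
    where
    R⊆Y : R ⊆ Y
    R⊆Y = R∪v⊆Y ∘ p⊆p∪q ⁅ v ⁆
    v∈Y : v ∈ Y
    v∈Y = R∪v⊆Y (x∈p∪⁅x⁆ R v)

  splice-length≤ : {H R W : Subset n} {L₀ L₁ Ys : List (Subset n)} →
                   ExitsOnlyThrough W R v → r ∈ H → u ∈ H → Adj G v u → v ∉ R →
                   L₀ Enumerates ConnectedBetween H R → L₁ Enumerates ConnectedBetween (H ∪ ⁅ v ⁆) W →
                   Unique Ys → All (ConnectedBetween (R ∪ ⁅ v ⁆) W) Ys →
                   length L₀ * length Ys ≤ length L₁
  splice-length≤ {v = v} {R = R} {L₀ = L₀} {L₁} {Ys}
                 exits r∈H u∈H v~u v∉R (L₀! , L₀⇔) (_ , L₁⇔) Ys! Ys-between =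
    subst (_≤ length L₁) (length-cartesianProduct L₀ Ys)
      (length≤-by-injection (splice R) (cartesianProduct⁺ L₀! Ys!) injective lands-in-L₁)
    where
    U-between : ∀ {U} → U ∈L L₀ → ConnectedBetween _ R U
    U-between = Equivalence.to (L₀⇔ _)

    Y-between : ∀ {Y} → Y ∈L Ys → ConnectedBetween (R ∪ ⁅ v ⁆) _ Y
    Y-between = All.lookup Ys-between

    ⊆R : ∀ {U} → U ∈L L₀ → U ⊆ R
    ⊆R = proj₁ ∘ proj₂ ∘ U-between

    R⊆ : ∀ {Y} → Y ∈L Ys → R ⊆ Y
    R⊆ Y∈Ys = proj₁ (Y-between Y∈Ys) ∘ p⊆p∪q ⁅ v ⁆

    injective : InjectiveOn (splice R) (cartesianProduct L₀ Ys)
    injective UY∈ U′Y′∈ eq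
      with U∈L₀ , Y∈Ys ← ∈-cartesianProduct⁻ L₀ Ys UY∈ | U′∈L₀ , Y′∈Ys ← ∈-cartesianProduct⁻ L₀ Ys U′Y′∈
      with refl , refl ← ∪-∩∁-injective (⊆R U∈L₀) (⊆R U′∈L₀) (R⊆ Y∈Ys) (R⊆ Y′∈Ys) eq = refl

    lands-in-L₁ : ∀ {UY} → UY ∈L cartesianProduct L₀ Ys → splice R UY ∈L L₁
    lands-in-L₁ UY∈ with U∈L₀ , Y∈Ys ← ∈-cartesianProduct⁻ L₀ Ys UY∈ =
      Equivalence.from (L₁⇔ _) (splice-between exits r∈H u∈H v~u v∉R (U-between U∈L₀) (Y-between Y∈Ys))

  module LargestAvoiding {H W : Subset n} {L₀ : List (Subset n)}
    (r∈H : r ∈ H) (H-conn : ConnectedSet G H) (H⊆W : H ⊆ W) (v∉H : v ∉ H)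
    (L₀-enum : L₀ Enumerates (λ U → ConnectedBetween H W U × v ∉ U)) where

    Avoiding : Subset n → Set
    Avoiding U = ConnectedBetween H W U × v ∉ U

    ∪-avoiding : Avoiding A → Avoiding B → Avoiding (A ∪ B)
    ∪-avoiding {A = A} {B = B} ((H⊆A , A⊆W , A-conn) , v∉A) ((H⊆B , B⊆W , B-conn) , v∉B) =
      (p⊆p∪q B ∘ H⊆A , ∪-⊆ A⊆W B⊆W , ∪-connected (H⊆A r∈H) (H⊆B r∈H) A-conn B-conn) ,
      λ v∈A∪B → [ v∉A , v∉B ]′ (x∈p∪q⁻ A B v∈A∪B)

    R : Subset n
    R = foldr _∪_ H L₀

    R-avoiding : Avoiding R
    R-avoiding = foldr-∪-closed ∪-avoiding ((⊆-refl , H⊆W , H-conn) , v∉H)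
                   (All.tabulate λ {U} U∈L₀ → Equivalence.to (proj₂ L₀-enum U) U∈L₀)

    H⊆R : H ⊆ R
    H⊆R = proj₁ (proj₁ R-avoiding)

    R⊆W : R ⊆ W
    R⊆W = proj₁ (proj₂ (proj₁ R-avoiding))

    R-conn : ConnectedSet G R
    R-conn = proj₂ (proj₂ (proj₁ R-avoiding))

    v∉R : v ∉ R
    v∉R = proj₂ R-avoiding

    avoiding⇒⊆R : Avoiding U → U ⊆ R
    avoiding⇒⊆R {U = U} U-avoiding = ⊆-foldr-∪ (Equivalence.from (proj₂ L₀-enum U) U-avoiding)

    L₀-enumerates : L₀ Enumerates ConnectedBetween H R
    L₀-enumerates = Enumerates-resp-⇔ avoiding⇔below-R L₀-enum
      where
      avoiding⇔below-R : ∀ U → Avoiding U ⇔ ConnectedBetween H R U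
      avoiding⇔below-R U = mk⇔
        (λ U-avoiding@((H⊆U , _ , U-conn) , _) → H⊆U , avoiding⇒⊆R U-avoiding , U-conn)
        (λ (H⊆U , U⊆R , U-conn) → (H⊆U , R⊆W ∘ U⊆R , U-conn) , v∉R ∘ U⊆R)

    R-exits-only-through-v : ExitsOnlyThrough W R v
    R-exits-only-through-v {x} x∈W x≢v x~w w∈R = avoiding⇒⊆R R∪x-avoiding (x∈p∪⁅x⁆ R x)
      where
      R∪x-avoiding : Avoiding (R ∪ ⁅ x ⁆)
      R∪x-avoiding = (p⊆p∪q ⁅ x ⁆ ∘ H⊆R , p∪⁅x⁆⊆q R⊆W x∈W , ∪⁅⁆-connected R-conn w∈R x~w) ,
                     λ v∈R∪x → [ v∉R , (λ v∈x → x≢v (≡.sym (x∈⁅y⁆⇒x≡y x v∈x))) ]′ (x∈p∪q⁻ R ⁅ x ⁆ v∈R∪x)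

    splice-count : {L₁ : List (Subset n)} → ConnectedSet G W → v ∈ W → u ∈ H → Adj G v u →
                   L₁ Enumerates ConnectedBetween (H ∪ ⁅ v ⁆) W →
                   ∃ λ d → length L₀ * d ≤ length L₁ × ∣ W ∣ ≤ d + ∣ R ∣
    splice-count W-conn v∈W u∈H v~u L₁-enum
      with Ys , Ys! , Ys-between , W<Ys+R∪v ←
             connected-chain ∣ W ∣ (m≤m+n ∣ W ∣ _) (x∈p∪⁅x⁆ R v) (∪⁅⁆-connected R-conn (H⊆R u∈H) v~u)
               W-conn (p∪⁅x⁆⊆q R⊆W v∈W) =
      length Ys ,
      splice-length≤ R-exits-only-through-v r∈H u∈H v~u v∉R L₀-enumerates L₁-enum Ys! Ys-between ,
      ≤-pred (subst (∣ W ∣ <_) (m+∣p∪⁅x⁆∣≡1+m+∣p∣ (length Ys) v∉R) W<Ys+R∪v)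

  average-size-bound-⊇ : {H W : Subset n} {L : List (Subset n)} →
                         ConnectedSet G H → H ⊆ W → W ⊆ H → L Enumerates ConnectedBetween H W →
                         (∣ W ∣ + ∣ H ∣) * length L ≤ 2 * sum (map ∣_∣ L)
  average-size-bound-⊇ {H} H-conn H⊆W W⊆H L-enum
    with refl ← Enumerates-≡⇒singleton (Enumerates-resp-⇔ (ConnectedBetween-⊇⇔≡ H-conn H⊆W W⊆H) L-enum)
    with refl ← ⊆-antisym W⊆H H⊆W =
    ≤-reflexive (solve 1 (λ h → (h :+ h) :* con 1 := con 2 :* (h :+ con 0)) refl ∣ H ∣)
    where open +-*-Solver using (solve; _:+_; _:*_; _:=_; con)

  average-size-bound : ∀ k {H W : Subset n} {L : List (Subset n)} →
                       ∣ W ∣ ≤ k + ∣ H ∣ → r ∈ H → ConnectedSet G H → ConnectedSet G W → H ⊆ W →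
                       L Enumerates ConnectedBetween H W →
                       (∣ W ∣ + ∣ H ∣) * length L ≤ 2 * sum (map ∣_∣ L)
  average-size-bound {r = r} k {H} {W} {L} W≤k+H r∈H H-conn W-conn H⊆W L-enum with ⊆⊎∃∉ W H
  ... | inj₁ W⊆H = average-size-bound-⊇ H-conn H⊆W W⊆H L-enum
  ... | inj₂ (x , x∈W , x∉H) with exit-edge (W-conn r x (H⊆W r∈H) x∈W) r∈H x∉H | k
  ...   | _ | zero = ⊥-elim (<⇒≱ (p⊂q⇒∣p∣<∣q∣ (H⊆W , x , x∈W , x∉H)) W≤k+H)
  ...   | u , v , u∈H , v∉H , v∈W , u~v | suc k =
    subst₂ (λ N S → (∣ W ∣ + ∣ H ∣) * N ≤ 2 * S)
      (≡.sym (length-filter-split (v ∈?_) L)) (≡.sym (sum-map-filter-split (v ∈?_) L ∣_∣))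
      (averages-combine (sum (map ∣_∣ L₀)) (sum (map ∣_∣ L₁)) bound₀ bound₁
        (splice-count W-conn v∈W u∈H (sym G u~v) L₁-enum))
    where
    L₀ L₁ : List (Subset n)
    L₀ = filter (¬? ∘ (v ∈?_)) L
    L₁ = filter (v ∈?_) L

    L₁-enum : L₁ Enumerates ConnectedBetween (H ∪ ⁅ v ⁆) W
    L₁-enum = Enumerates-resp-⇔ ConnectedBetween-∋⇔∪⁅⁆ (filter-Enumerates (v ∈?_) L-enum)

    open LargestAvoiding r∈H H-conn H⊆W v∉H (filter-Enumerates (¬? ∘ (v ∈?_)) L-enum)

    bound₀ : (∣ R ∣ + ∣ H ∣) * length L₀ ≤ 2 * sum (map ∣_∣ L₀)
    bound₀ = average-size-bound k (≤-pred (<-≤-trans (p⊂q⇒∣p∣<∣q∣ (R⊆W , v , v∈W , v∉R)) W≤k+H))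
               r∈H H-conn R-conn H⊆R L₀-enumerates

    bound₁ : suc (∣ W ∣ + ∣ H ∣) * length L₁ ≤ 2 * sum (map ∣_∣ L₁)
    bound₁ = subst (λ m → m * length L₁ ≤ 2 * sum (map ∣_∣ L₁)) (m+∣p∪⁅x⁆∣≡1+m+∣p∣ ∣ W ∣ v∉H)
               (average-size-bound k (subst (∣ W ∣ ≤_) (≡.sym (m+∣p∪⁅x⁆∣≡1+m+∣p∣ k v∉H)) W≤k+H)
                 (p⊆p∪q ⁅ v ⁆ r∈H) (∪⁅⁆-connected H-conn u∈H (sym G u~v)) W-conn
                 (p∪⁅x⁆⊆q H⊆W v∈W) L₁-enum)

theorem3p1 : (n : ℕ) (G : Graph n) → ConnectedGraph G →
    (H : Subset n) → ConnectedSet G H → 1 ≤ ∣ H ∣ →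
    (L : List (Subset n)) → Unique L →
    (∀ U → (U ∈L L) ⇔ ((H ⊆ U) × ConnectedSet G U)) →
    2 * sum (map ∣_∣ L) ≥ (n + ∣ H ∣) * length L
theorem3p1 n G G-conn H H-conn 1≤∣H∣ L L! L⇔ with r , r∈H ← 1≤∣p∣⇒Nonempty 1≤∣H∣ =
  subst (λ m → (m + ∣ H ∣) * length L ≤ 2 * sum (map ∣_∣ L)) (∣⊤∣≡n n)
    (average-size-bound G ∣ ⊤ {n} ∣ (m≤m+n ∣ ⊤ {n} ∣ ∣ H ∣) r∈H H-conn G-conn ⊆⊤
      (Enumerates-resp-⇔ (ConnectedBetween-⊤⇔ G) (L! , L⇔)))
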